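{- Let $n\ge 1$, $0\le d\le n-1$ and $m\ge 0$ be integers. Let $\pi$ be chosen uniformly at random from $S_n$, and let $\mu_m$ be the conditional expectation of $\pi(1)^{\overline{m}}$ given $\mathrm{Des}(\pi)=d$. Then \[ \left\langle {n \atop d} \right\rangle \mu_m = m! \sum_{j \ge 0} (-1)^{d-j} \binom{n}{d-j} \sum_{\ell=0}^{n-1} \binom{m+n}{\ell} j^{\ell}. \]
   Context: $S_n$ is the set of permutations of $\{1,\dots,n\}$. A descent of $\pi\in S_n$ is an index $i$ with $1\le i\le n-1$ and $\pi(i)>\pi(i+1)$; $\mathrm{Des}(\pi)$ is the number of descents. The Eulerian number $\left\langle {n \atop d} \right\rangle$ is the number of $\pi\in S_n$ with $\mathrm{Des}(\pi)=d$. The rising factorial is $x^{\overline{m}}=x(x+1)\cdots(x+m-1)$ (with $x^{\overline 0}=1$). Binomial coefficients $\binom{n}{r}$ are $0$ for $r<0$ or $r>n$, and $0^0=1$. -}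

module Defs where

open import Data.Nat using (ℕ; zero; suc; _+_; _*_; _∸_; _<ᵇ_)
open import Data.Nat.Combinatorics using (_C_)
open import Data.Nat using (_!)
open import Data.Integer as ℤ using (ℤ; +_; -1ℤ)
open import Data.Fin using (Fin; toℕ)
open import Data.Fin.Properties using () renaming (_≟_ to _≟F_)
open import Data.Vec using (Vec; []; _∷_; toList)
open import Data.List using (List; []; _∷_; [_]; map; concatMap; filter; length; allFin)
open import Data.Bool using (if_then_else_)

sumℕ : ℕ → (ℕ → ℕ) → ℕ
sumℕ zero    f = 0
sumℕ (suc k) f = sumℕ k f + f k

sumℤ : ℕ → (ℕ → ℤ) → ℤ
sumℤ zero    f = + 0
sumℤ (suc k) f = sumℤ k f ℤ.+ f k

sumL : {A : Set} → (A → ℕ) → List A → ℕ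
sumL f []       = 0
sumL f (x ∷ xs) = f x + sumL f xs

allSeqs : (n k : ℕ) → List (Vec (Fin n) k)
allSeqs n zero    = [ [] ]
allSeqs n (suc k) = concatMap (λ i → map (i ∷_) (allSeqs n k)) (allFin n)

-- S_n: the injective (hence bijective) sequences of length n in Fin n.
-- A permutation π is stored as the vector (π(1)-1, …, π(n)-1).
Sn : (n : ℕ) → List (Vec (Fin n) n)
Sn n = filter (λ v → unique? (toList v)) (allSeqs n n)
  where open import Data.List.Relation.Unary.Unique.DecPropositional (_≟F_ {n}) using (unique?)

oneLine : {n : ℕ} → Vec (Fin n) n → List ℕ
oneLine v = map (λ i → suc (toℕ i)) (toList v)

desL : List ℕ → ℕ
desL (x ∷ y ∷ r) = (if y <ᵇ x then 1 else 0) + desL (y ∷ r)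
desL _           = 0

Des : {n : ℕ} → Vec (Fin n) n → ℕ
Des v = desL (oneLine v)

-- π(1) (the value at position 1); the [] case only arises for n = 0
firstL : List ℕ → ℕ
firstL []      = 0
firstL (x ∷ _) = x

first : {n : ℕ} → Vec (Fin n) n → ℕ
first v = firstL (oneLine v)

SnDes : (n d : ℕ) → List (Vec (Fin n) n)
SnDes n d = filter (λ π → Des π Data.Nat.≟ d) (Sn n)
  where import Data.Nat

eulerian : ℕ → ℕ → ℕ
eulerian n d = length (SnDes n d)

rising : ℕ → ℕ → ℕ
rising x zero    = 1
rising x (suc m) = rising x m * (x + m)

-- ⟨n d⟩ · μ_m  =  Σ_{π ∈ S_n, Des π = d} π(1)^(m rising)
-- (conditional expectation times the size of the conditioning event)
eulerianTimesCondExp : ℕ → ℕ → ℕ → ℕ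
eulerianTimesCondExp n d m = sumL (λ π → rising (first π) m) (SnDes n d)

-- binomial with C(n, d - j) = 0 when j > d
binomDiff : ℕ → ℕ → ℕ → ℕ
binomDiff n d j = if d <ᵇ j then 0 else n C (d ∸ j)

-- right-hand side:  m! Σ_{j ≥ 0} (-1)^{d-j} C(n,d-j) Σ_{ℓ=0}^{n-1} C(m+n,ℓ) j^ℓ
-- terms with j > d vanish, so the j-sum is over 0 ≤ j ≤ d.
rhs : ℕ → ℕ → ℕ → ℤ
rhs n d m = + (m !) ℤ.* sumℤ (suc d) (λ j →
              (-1ℤ ℤ.^ (d ∸ j)) ℤ.* + (binomDiff n d j)
                ℤ.* + (sumℕ n (λ ℓ → ((m + n) C ℓ) * (j Data.Nat.^ ℓ))))
  where import Data.Nat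

{-# OPTIONS --safe #-}
module Submission where

-- Let a(N,d,x) be the number of permutations of {1,…,N+1} with d descents and first value x+1,
-- so that the left-hand side is Σ_x (x+1)^(m rising) a(N,d,x). Deleting the first letter and
-- standardising the rest gives the recursion
--   a(N+1,d,x) = Σ_{y ≥ x} a(N,d,y) + Σ_{y < x} a(N,d-1,y),
-- whose solution is a(N,d,x) = Σ_{j ≤ d} (-1)^(d-j) C(N+1,d-j) j^x (j+1)^(N-x): the partial sums
-- of j^y (j+1)^(N-y) over y ≥ x and over y < x telescope, and Pascal's rule turns C(N+1,·) into
-- C(N+2,·). Finally (x+1)^(m rising) = m! C(m+x,x), and
--   Σ_{x ≤ N} C(m+x,x) j^x (j+1)^(N-x) = Σ_{ℓ ≤ N} C(m+N+1,ℓ) j^ℓ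
-- by induction on N, using Pascal's rule once more.

module PowerSums where

  open import Defs using (sumℕ; rising)
  open import Data.Nat using (ℕ; zero; suc; _+_; _*_; _∸_; _^_; _<ᵇ_; _≤_; _<_; _!; z≤n; s≤s)
  open import Data.Nat.Properties
    using (≤-refl; ≤-trans; ≤-pred; m≤n⇒m<n∨m≡n; n≤1+n; *-zeroʳ; *-identityˡ; *-identityʳ; *-comm;
           *-distribˡ-+; +-suc; +-∸-assoc; n∸n≡0; +-identityʳ; +-assoc; *-assoc; +-commutativeSemigroup; *-commutativeSemigroup)
  open import Data.Nat.Combinatorics using (_C_; nCn≡1; nCk+nC[k+1]≡[n+1]C[k+1])
  open import Data.Nat.Tactic.RingSolver using (solve-∀)
  open import Data.Bool using (Bool; true; false; not; if_then_else_)
  open import Relation.Binary.PropositionalEquality using (_≡_; refl; sym; trans; cong; cong₂; module ≡-Reasoning)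
  open import Data.Sum using (inj₁; inj₂)
  open import Algebra.Properties.CommutativeSemigroup +-commutativeSemigroup using () renaming (interchange to +-interchange)
  open import Algebra.Properties.CommutativeSemigroup *-commutativeSemigroup using () renaming (x∙yz≈y∙xz to *-leftComm)

  ⟦_⟧ : Bool → ℕ
  ⟦ b ⟧ = if b then 1 else 0

  atLeast below : ℕ → ℕ → ℕ
  atLeast x y = ⟦ not (y <ᵇ x) ⟧
  below x y = ⟦ y <ᵇ x ⟧

  atLeast-≤ : ∀ {x y} → x ≤ y → atLeast x y ≡ 1
  atLeast-≤ {zero} _ = refl
  atLeast-≤ {suc x} {suc y} (s≤s x≤y) = atLeast-≤ x≤y

  atLeast-> : ∀ {x y} → y < x → atLeast x y ≡ 0
  atLeast-> {suc x} {zero} _ = refl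
  atLeast-> {suc x} {suc y} (s≤s y<x) = atLeast-> y<x

  below*+atLeast* : ∀ x y a → below x y * a + atLeast x y * a ≡ a
  below*+atLeast* x y a with y <ᵇ x
  ... | true = trans (+-identityʳ (1 * a)) (*-identityˡ a)
  ... | false = *-identityˡ a

  sumℕ-cong : ∀ K {f g : ℕ → ℕ} → (∀ i → i < K → f i ≡ g i) → sumℕ K f ≡ sumℕ K g
  sumℕ-cong zero eq = refl
  sumℕ-cong (suc K) eq = cong₂ _+_ (sumℕ-cong K (λ i i<K → eq i (≤-trans i<K (n≤1+n K)))) (eq K ≤-refl)

  sumℕ-zero : ∀ K {f : ℕ → ℕ} → (∀ i → i < K → f i ≡ 0) → sumℕ K f ≡ 0
  sumℕ-zero K eq = trans (sumℕ-cong K eq) (sumℕ-const-zero K)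
    where
    sumℕ-const-zero : ∀ K → sumℕ K (λ _ → 0) ≡ 0
    sumℕ-const-zero zero = refl
    sumℕ-const-zero (suc K) = cong (_+ 0) (sumℕ-const-zero K)

  sumℕ-+ : ∀ K (f g : ℕ → ℕ) → sumℕ K (λ i → f i + g i) ≡ sumℕ K f + sumℕ K g
  sumℕ-+ zero f g = refl
  sumℕ-+ (suc K) f g = trans (cong (_+ (f K + g K)) (sumℕ-+ K f g)) (+-interchange (sumℕ K f) (sumℕ K g) (f K) (g K))

  sumℕ-*ˡ : ∀ K c (f : ℕ → ℕ) → sumℕ K (λ i → c * f i) ≡ c * sumℕ K f
  sumℕ-*ˡ zero c f = sym (*-zeroʳ c)
  sumℕ-*ˡ (suc K) c f = trans (cong (_+ c * f K) (sumℕ-*ˡ K c f)) (sym (*-distribˡ-+ c (sumℕ K f) (f K)))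

  sumℕ-head : ∀ K (f : ℕ → ℕ) → sumℕ (suc K) f ≡ f 0 + sumℕ K (λ i → f (suc i))
  sumℕ-head zero f = sym (+-identityʳ (f 0))
  sumℕ-head (suc K) f = trans (cong (_+ f (suc K)) (sumℕ-head K f)) (+-assoc (f 0) _ _)

  mixedPow : ℕ → ℕ → ℕ → ℕ
  mixedPow N j x = j ^ x * suc j ^ (N ∸ x)

  mixedPow-suc : ∀ {N x} j → x ≤ N → mixedPow (suc N) j x ≡ suc j * mixedPow N j x
  mixedPow-suc {N} {x} j x≤N = trans (cong (λ e → j ^ x * suc j ^ e) (+-∸-assoc 1 x≤N)) (*-leftComm (j ^ x) (suc j) (suc j ^ (N ∸ x)))

  mixedPow-diag : ∀ N j → mixedPow N j N ≡ j ^ N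
  mixedPow-diag N j = trans (cong (λ e → j ^ N * suc j ^ e) (n∸n≡0 N)) (*-identityʳ (j ^ N))

  sumℕ-mixedPow-suc : ∀ N j (w : ℕ → ℕ) →
    sumℕ (suc N) (λ x → w x * mixedPow (suc N) j x) ≡ suc j * sumℕ (suc N) (λ x → w x * mixedPow N j x)
  sumℕ-mixedPow-suc N j w =
    trans (sumℕ-cong (suc N) (λ x x<N+1 → trans (cong (w x *_) (mixedPow-suc j (≤-pred x<N+1))) (*-leftComm (w x) (suc j) (mixedPow N j x))))
          (sumℕ-*ˡ (suc N) (suc j) (λ x → w x * mixedPow N j x))

  sumℕ-atLeast-mixedPow : ∀ N j {x} → x ≤ suc N →
    sumℕ (suc N) (λ y → atLeast x y * mixedPow N j y) + j ^ suc N ≡ mixedPow (suc N) j x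
  sumℕ-atLeast-mixedPow zero j {zero} _ = base j
    where
    base : ∀ j → 0 + 1 * (1 * 1) + j * 1 ≡ 1 * ((1 + j) * 1)
    base = solve-∀
  sumℕ-atLeast-mixedPow zero j {suc zero} _ = base j
    where
    base : ∀ j → 0 + 0 + j * 1 ≡ (j * 1) * 1
    base = solve-∀
  sumℕ-atLeast-mixedPow zero j {suc (suc _)} (s≤s ())
  sumℕ-atLeast-mixedPow (suc N) j {x} x≤ with m≤n⇒m<n∨m≡n x≤
  ... | inj₁ x<N+2 = begin
    sumℕ (suc N) (λ y → atLeast x y * mixedPow (suc N) j y) + atLeast x (suc N) * mixedPow (suc N) j (suc N) + j ^ suc (suc N)
      ≡⟨ cong₂ (λ s t → s + t + j ^ suc (suc N)) (sumℕ-mixedPow-suc N j (atLeast x)) (cong₂ _*_ (atLeast-≤ x≤N+1) (mixedPow-diag (suc N) j)) ⟩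
    suc j * S + 1 * j ^ suc N + j * j ^ suc N
      ≡⟨ factor j S (j ^ suc N) ⟩
    suc j * (S + j ^ suc N)
      ≡⟨ cong (suc j *_) (sumℕ-atLeast-mixedPow N j x≤N+1) ⟩
    suc j * mixedPow (suc N) j x
      ≡⟨ sym (mixedPow-suc j x≤N+1) ⟩
    mixedPow (suc (suc N)) j x ∎
    where
    open ≡-Reasoning
    x≤N+1 : x ≤ suc N
    x≤N+1 = ≤-pred x<N+2
    S : ℕ
    S = sumℕ (suc N) (λ y → atLeast x y * mixedPow N j y)
    factor : ∀ j s p → (1 + j) * s + 1 * p + j * p ≡ (1 + j) * (s + p)
    factor = solve-∀
  ... | inj₂ refl =
    trans (cong (_+ j ^ suc (suc N)) (sumℕ-zero (suc (suc N)) (λ y y<x → cong (_* mixedPow (suc N) j y) (atLeast-> y<x))))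
          (sym (mixedPow-diag (suc (suc N)) j))

  sumℕ-below-mixedPow : ∀ N j {x} → x ≤ suc N →
    sumℕ (suc N) (λ y → below x y * mixedPow N j y) + mixedPow (suc N) j x ≡ suc j ^ suc N
  sumℕ-below-mixedPow N j {x} x≤ = begin
    L + mixedPow (suc N) j x             ≡⟨ cong (L +_) (sym (sumℕ-atLeast-mixedPow N j x≤)) ⟩
    L + (U + j ^ suc N)                  ≡⟨ sym (+-assoc L U (j ^ suc N)) ⟩
    L + U + j ^ suc N                    ≡⟨ cong (_+ j ^ suc N) (trans (sym (sumℕ-+ (suc N) _ _)) (sumℕ-cong (suc N) unweighted)) ⟩
    sumℕ (suc N) (λ y → atLeast 0 y * mixedPow N j y) + j ^ suc N ≡⟨ sumℕ-atLeast-mixedPow N j z≤n ⟩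
    1 * suc j ^ suc N                    ≡⟨ *-identityˡ (suc j ^ suc N) ⟩
    suc j ^ suc N ∎
    where
    open ≡-Reasoning
    L U : ℕ
    L = sumℕ (suc N) (λ y → below x y * mixedPow N j y)
    U = sumℕ (suc N) (λ y → atLeast x y * mixedPow N j y)
    unweighted : ∀ y → y < suc N → below x y * mixedPow N j y + atLeast x y * mixedPow N j y ≡ 1 * mixedPow N j y
    unweighted y _ = trans (below*+atLeast* x y (mixedPow N j y)) (sym (*-identityˡ (mixedPow N j y)))

  rising-suc : ∀ x m → rising x (suc m) ≡ x * rising (suc x) m
  rising-suc x zero = trans (*-identityˡ (x + 0)) (trans (+-identityʳ x) (sym (*-identityʳ x)))
  rising-suc x (suc m) = trans (cong₂ _*_ (rising-suc x m) (+-suc x m)) (*-assoc x (rising (suc x) m) (suc x + m))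

  rising-one : ∀ m → rising 1 m ≡ m !
  rising-one zero = refl
  rising-one (suc m) = trans (cong (_* suc m) (rising-one m)) (*-comm (m !) (suc m))

  rising≡binomial : ∀ k m → rising (suc k) m ≡ m ! * ((m + k) C k)
  rising≡binomial k zero = sym (cong (1 *_) (nCn≡1 k))
  rising≡binomial zero (suc m) = trans (rising-one (suc m)) (sym (*-identityʳ (suc m !)))
  rising≡binomial (suc k) (suc m) = begin
    rising (suc (suc k)) (suc m)
      ≡⟨ pascal ⟩
    rising (suc k) (suc m) + suc m * rising (suc (suc k)) m
      ≡⟨ cong₂ (λ a b → a + suc m * b) (rising≡binomial k (suc m)) (rising≡binomial (suc k) m) ⟩
    suc m ! * (suc (m + k) C k) + suc m * (m ! * ((m + suc k) C suc k))
      ≡⟨ cong (λ n → suc m ! * (suc (m + k) C k) + suc m * (m ! * (n C suc k))) (+-suc m k) ⟩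
    suc m ! * (suc (m + k) C k) + suc m * (m ! * (suc (m + k) C suc k))
      ≡⟨ factor (suc m) (m !) (suc (m + k) C k) (suc (m + k) C suc k) ⟩
    suc m ! * (suc (m + k) C k + suc (m + k) C suc k)
      ≡⟨ cong (suc m ! *_) (nCk+nC[k+1]≡[n+1]C[k+1] (suc (m + k)) k) ⟩
    suc m ! * (suc (suc (m + k)) C suc k)
      ≡⟨ cong (λ n → suc m ! * (suc n C suc k)) (sym (+-suc m k)) ⟩
    suc m ! * ((suc m + suc k) C suc k) ∎
    where
    open ≡-Reasoning
    factor : ∀ s f a b → s * f * a + s * (f * b) ≡ s * f * (a + b)
    factor = solve-∀
    split : ∀ r k m → r * (2 + k + m) ≡ (1 + k) * r + (1 + m) * r
    split = solve-∀
    pascal : rising (suc (suc k)) (suc m) ≡ rising (suc k) (suc m) + suc m * rising (suc (suc k)) m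
    pascal = trans (split (rising (suc (suc k)) m) k m) (cong (_+ suc m * rising (suc (suc k)) m) (sym (rising-suc (suc k) m)))

  sumℕ-binomial-suc : ∀ M K j →
    sumℕ (suc K) (λ l → (suc M C l) * j ^ l) ≡ suc j * sumℕ K (λ l → (M C l) * j ^ l) + (M C K) * j ^ K
  sumℕ-binomial-suc M zero j = cong (_+ 1) (sym (*-zeroʳ (suc j)))
  sumℕ-binomial-suc M (suc K) j = begin
    sumℕ (suc K) (λ l → (suc M C l) * j ^ l) + (suc M C suc K) * j ^ suc K
      ≡⟨ cong₂ (λ s c → s + c * j ^ suc K) (sumℕ-binomial-suc M K j) (sym (nCk+nC[k+1]≡[n+1]C[k+1] M K)) ⟩
    suc j * S + (M C K) * j ^ K + ((M C K) + (M C suc K)) * j ^ suc K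
      ≡⟨ regroup j S (M C K) (M C suc K) (j ^ K) ⟩
    suc j * (S + (M C K) * j ^ K) + (M C suc K) * j ^ suc K ∎
    where
    open ≡-Reasoning
    S : ℕ
    S = sumℕ K (λ l → (M C l) * j ^ l)
    regroup : ∀ j S a b p → (1 + j) * S + a * p + (a + b) * (j * p) ≡ (1 + j) * (S + a * p) + b * (j * p)
    regroup = solve-∀

  sumℕ-binomial-mixedPow : ∀ m N j →
    sumℕ (suc N) (λ x → ((m + x) C x) * mixedPow N j x) ≡ sumℕ (suc N) (λ l → ((m + suc N) C l) * j ^ l)
  sumℕ-binomial-mixedPow m zero j = refl
  sumℕ-binomial-mixedPow m (suc N) j = begin
    sumℕ (suc N) (λ x → ((m + x) C x) * mixedPow (suc N) j x) + ((m + suc N) C suc N) * mixedPow (suc N) j (suc N)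
      ≡⟨ cong₂ (λ s p → s + ((m + suc N) C suc N) * p) (sumℕ-mixedPow-suc N j (λ x → (m + x) C x)) (mixedPow-diag (suc N) j) ⟩
    suc j * sumℕ (suc N) (λ x → ((m + x) C x) * mixedPow N j x) + ((m + suc N) C suc N) * j ^ suc N
      ≡⟨ cong (λ s → suc j * s + ((m + suc N) C suc N) * j ^ suc N) (sumℕ-binomial-mixedPow m N j) ⟩
    suc j * sumℕ (suc N) (λ l → ((m + suc N) C l) * j ^ l) + ((m + suc N) C suc N) * j ^ suc N
      ≡⟨ sym (sumℕ-binomial-suc (m + suc N) (suc N) j) ⟩
    sumℕ (suc (suc N)) (λ l → (suc (m + suc N) C l) * j ^ l)
      ≡⟨ cong (λ n → sumℕ (suc (suc N)) (λ l → (n C l) * j ^ l)) (sym (+-suc m (suc N))) ⟩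
    sumℕ (suc (suc N)) (λ l → ((m + suc (suc N)) C l) * j ^ l) ∎
    where open ≡-Reasoning

  sumℕ-rising-mixedPow : ∀ m N j →
    sumℕ (suc N) (λ x → rising (suc x) m * mixedPow N j x) ≡ m ! * sumℕ (suc N) (λ l → ((m + suc N) C l) * j ^ l)
  sumℕ-rising-mixedPow m N j = begin
    sumℕ (suc N) (λ x → rising (suc x) m * mixedPow N j x)
      ≡⟨ sumℕ-cong (suc N) (λ x _ → trans (cong (_* mixedPow N j x) (rising≡binomial x m)) (*-assoc (m !) _ _)) ⟩
    sumℕ (suc N) (λ x → m ! * (((m + x) C x) * mixedPow N j x))
      ≡⟨ sumℕ-*ˡ (suc N) (m !) _ ⟩
    m ! * sumℕ (suc N) (λ x → ((m + x) C x) * mixedPow N j x)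
      ≡⟨ cong (m ! *_) (sumℕ-binomial-mixedPow m N j) ⟩
    m ! * sumℕ (suc N) (λ l → ((m + suc N) C l) * j ^ l) ∎
    where open ≡-Reasoning

module Permutations where

  open import Defs
  open PowerSums using (⟦_⟧; atLeast; below; sumℕ-head)
  open import Data.Nat using (ℕ; zero; suc; _+_; _*_; _<ᵇ_; _≡ᵇ_)
  open import Data.Nat.Properties using (*-zeroʳ; *-identityˡ; *-identityʳ; *-distribˡ-+; +-assoc; +-identityʳ; +-0-monoid; +-commutativeSemigroup)
  open import Data.Fin using (Fin; toℕ; punchIn) renaming (zero to fzero; suc to fsuc)
  open import Data.Fin.Properties using (punchIn-injective) renaming (_≟_ to _≟F_)
  open import Data.Vec using (Vec; []; _∷_; head; map; toList)
  open import Data.List using (List; []; _∷_; _++_; concatMap; filter; allFin; tabulate)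
  import Data.List as List
  open import Data.List.Relation.Unary.All using (all?)
  open import Data.Bool using (Bool; true; false; not; _∧_; if_then_else_)
  open import Data.Bool.Properties using (∧-assoc; ∧-zeroʳ)
  open import Data.Empty using (⊥-elim)
  open import Relation.Nullary using (does; yes; no; ¬?)
  open import Relation.Unary using (Pred; Decidable)
  open import Relation.Binary.PropositionalEquality using (_≡_; refl; sym; trans; cong; cong₂; module ≡-Reasoning)
  open import Algebra.Properties.Monoid.Sum +-0-monoid using (sum; sum-cong-≗)
  open import Algebra.Properties.CommutativeSemigroup +-commutativeSemigroup using () renaming (interchange to +-interchange)
  open import Level using (0ℓ)

  module _ {A : Set} where

    sumL-cong : ∀ {f g : A → ℕ} xs → (∀ x → f x ≡ g x) → sumL f xs ≡ sumL g xs
    sumL-cong [] eq = refl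
    sumL-cong (x ∷ xs) eq = cong₂ _+_ (eq x) (sumL-cong xs eq)

    sumL-zero : ∀ xs → sumL (λ (_ : A) → 0) xs ≡ 0
    sumL-zero [] = refl
    sumL-zero (x ∷ xs) = sumL-zero xs

    sumL-+ : ∀ (f g : A → ℕ) xs → sumL (λ x → f x + g x) xs ≡ sumL f xs + sumL g xs
    sumL-+ f g [] = refl
    sumL-+ f g (x ∷ xs) = trans (cong (f x + g x +_) (sumL-+ f g xs)) (+-interchange (f x) (g x) (sumL f xs) (sumL g xs))

    sumL-*ˡ : ∀ c (f : A → ℕ) xs → sumL (λ x → c * f x) xs ≡ c * sumL f xs
    sumL-*ˡ c f [] = sym (*-zeroʳ c)
    sumL-*ˡ c f (x ∷ xs) = trans (cong (c * f x +_) (sumL-*ˡ c f xs)) (sym (*-distribˡ-+ c (f x) (sumL f xs)))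

    sumL-++ : ∀ (f : A → ℕ) xs ys → sumL f (xs ++ ys) ≡ sumL f xs + sumL f ys
    sumL-++ f [] ys = refl
    sumL-++ f (x ∷ xs) ys = trans (cong (f x +_) (sumL-++ f xs ys)) (sym (+-assoc (f x) _ _))

    sumL-map : ∀ {B : Set} (f : A → ℕ) (g : B → A) xs → sumL f (List.map g xs) ≡ sumL (λ x → f (g x)) xs
    sumL-map f g [] = refl
    sumL-map f g (x ∷ xs) = cong (f (g x) +_) (sumL-map f g xs)

    sumL-concatMap : ∀ {B : Set} (f : A → ℕ) (g : B → List A) xs →
      sumL f (concatMap g xs) ≡ sumL (λ x → sumL f (g x)) xs
    sumL-concatMap f g [] = refl
    sumL-concatMap f g (x ∷ xs) = trans (sumL-++ f (g x) (concatMap g xs)) (cong (sumL f (g x) +_) (sumL-concatMap f g xs))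

    sumL-tabulate : ∀ n (f : A → ℕ) (g : Fin n → A) → sumL f (tabulate g) ≡ sum (λ i → f (g i))
    sumL-tabulate zero f g = refl
    sumL-tabulate (suc n) f g = cong (f (g fzero) +_) (sumL-tabulate n f (λ i → g (fsuc i)))

    sumL-filter : ∀ {P : Pred A 0ℓ} (P? : Decidable P) (f : A → ℕ) xs →
      sumL f (filter P? xs) ≡ sumL (λ x → if does (P? x) then f x else 0) xs
    sumL-filter P? f [] = refl
    sumL-filter P? f (x ∷ xs) with does (P? x)
    ... | true = cong (f x +_) (sumL-filter P? f xs)
    ... | false = sumL-filter P? f xs

  sum-toℕ : ∀ K (f : ℕ → ℕ) → sum (λ (i : Fin K) → f (toℕ i)) ≡ sumℕ K f
  sum-toℕ zero f = refl
  sum-toℕ (suc K) f = trans (cong (f 0 +_) (sum-toℕ K (λ i → f (suc i)))) (sym (sumℕ-head K f))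

  sum-punchIn : ∀ M (i : Fin (suc M)) (f : Fin (suc M) → ℕ) →
    sum (λ j → if does (i ≟F j) then 0 else f j) ≡ sum (λ j → f (punchIn i j))
  sum-punchIn M fzero f = refl
  sum-punchIn (suc M) (fsuc i) f = cong (f fzero +_) (sum-punchIn M i (λ j → f (fsuc j)))

  sumL-allSeqs : ∀ M k (f : Vec (Fin M) (suc k) → ℕ) →
    sumL f (allSeqs M (suc k)) ≡ sum (λ i → sumL (λ w → f (i ∷ w)) (allSeqs M k))
  sumL-allSeqs M k f =
    trans (sumL-concatMap f _ (allFin M))
          (trans (sumL-tabulate M _ (λ i → i)) (sum-cong-≗ (λ i → sumL-map f (i ∷_) (allSeqs M k))))

  fresh : ∀ {n k} → Fin n → Vec (Fin n) k → Bool
  fresh i [] = true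
  fresh i (j ∷ w) = not (does (i ≟F j)) ∧ fresh i w

  distinct : ∀ {n k} → Vec (Fin n) k → Bool
  distinct [] = true
  distinct (i ∷ w) = fresh i w ∧ distinct w

  descents : ∀ {n k} → Vec (Fin n) k → ℕ
  descents [] = 0
  descents (a ∷ []) = 0
  descents (a ∷ b ∷ w) = ⟦ toℕ b <ᵇ toℕ a ⟧ + descents (b ∷ w)

  module _ {n : ℕ} where
    open import Data.List.Relation.Unary.Unique.DecPropositional (_≟F_ {n}) using (unique?)

    all?-fresh : ∀ {k} (i : Fin n) (w : Vec (Fin n) k) → does (all? (λ j → ¬? (i ≟F j)) (toList w)) ≡ fresh i w
    all?-fresh i [] = refl
    all?-fresh i (j ∷ w) = cong (not (does (i ≟F j)) ∧_) (all?-fresh i w)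

    unique?-distinct : ∀ {k} (v : Vec (Fin n) k) → does (unique? (toList v)) ≡ distinct v
    unique?-distinct [] = refl
    unique?-distinct (i ∷ w) = cong₂ _∧_ (all?-fresh i w) (unique?-distinct w)

  Des-descents : ∀ {n} (v : Vec (Fin n) n) → Des v ≡ descents v
  Des-descents v = desL-descents v
    where
    desL-descents : ∀ {n k} (v : Vec (Fin n) k) → desL (List.map (λ i → suc (toℕ i)) (toList v)) ≡ descents v
    desL-descents [] = refl
    desL-descents (a ∷ []) = refl
    desL-descents (a ∷ b ∷ w) = cong (⟦ toℕ b <ᵇ toℕ a ⟧ +_) (desL-descents (b ∷ w))

  -- Σ h (π(1) − 1) over the π ∈ S_(N+1) whose number of descents satisfies P (values are 0-based).
  permSum : ℕ → (ℕ → Bool) → (ℕ → ℕ) → ℕ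
  permSum N P h = sumL (λ v → h (toℕ (head v)) * ⟦ distinct v ∧ P (descents v) ⟧) (allSeqs (suc N) (suc N))

  eulerianTimesCondExp-permSum : ∀ N d m →
    eulerianTimesCondExp (suc N) d m ≡ permSum N (_≡ᵇ d) (λ x → rising (suc x) m)
  eulerianTimesCondExp-permSum N d m =
    trans (sumL-filter _ _ (filter _ (allSeqs (suc N) (suc N))))
          (trans (sumL-filter _ _ (allSeqs (suc N) (suc N))) (sumL-cong (allSeqs (suc N) (suc N)) summand))
    where
    open import Data.List.Relation.Unary.Unique.DecPropositional (_≟F_ {suc N}) using (unique?)
    guarded : ∀ u p x → (if u then (if p then x else 0) else 0) ≡ x * ⟦ u ∧ p ⟧
    guarded true true x = sym (*-identityʳ x)
    guarded true false x = sym (*-zeroʳ x)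
    guarded false p x = sym (*-zeroʳ x)
    summand : ∀ (v : Vec (Fin (suc N)) (suc N)) →
      (if does (unique? (toList v)) then (if Des v ≡ᵇ d then rising (first v) m else 0) else 0)
        ≡ rising (suc (toℕ (head v))) m * ⟦ distinct v ∧ (descents v ≡ᵇ d) ⟧
    summand v@(_ ∷ _) =
      trans (guarded (does (unique? (toList v))) (Des v ≡ᵇ d) (rising (first v) m))
            (cong₂ (λ u D → rising (first v) m * ⟦ u ∧ (D ≡ᵇ d) ⟧) (unique?-distinct v) (Des-descents v))

  module _ {M : ℕ} (i : Fin (suc M)) where

    ≟-punchIn : ∀ (a b : Fin M) → does (punchIn i a ≟F punchIn i b) ≡ does (a ≟F b)
    ≟-punchIn a b with punchIn i a ≟F punchIn i b | a ≟F b
    ... | yes _ | yes _ = refl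
    ... | no _ | no _ = refl
    ... | yes pa≡pb | no a≢b = ⊥-elim (a≢b (punchIn-injective i a b pa≡pb))
    ... | no pa≢pb | yes a≡b = ⊥-elim (pa≢pb (cong (punchIn i) a≡b))

    fresh-punchIn : ∀ {k} (a : Fin M) (w : Vec (Fin M) k) → fresh (punchIn i a) (map (punchIn i) w) ≡ fresh a w
    fresh-punchIn a [] = refl
    fresh-punchIn a (b ∷ w) = cong₂ (λ e f → not e ∧ f) (≟-punchIn a b) (fresh-punchIn a w)

    distinct-punchIn : ∀ {k} (w : Vec (Fin M) k) → distinct (map (punchIn i) w) ≡ distinct w
    distinct-punchIn [] = refl
    distinct-punchIn (a ∷ w) = cong₂ _∧_ (fresh-punchIn a w) (distinct-punchIn w)

  <ᵇ-punchIn : ∀ {M} (i : Fin (suc M)) (a b : Fin M) → (toℕ (punchIn i b) <ᵇ toℕ (punchIn i a)) ≡ (toℕ b <ᵇ toℕ a)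
  <ᵇ-punchIn fzero a b = refl
  <ᵇ-punchIn {suc M} (fsuc i) fzero fzero = refl
  <ᵇ-punchIn {suc M} (fsuc i) (fsuc a) fzero = refl
  <ᵇ-punchIn {suc M} (fsuc i) fzero (fsuc b) = refl
  <ᵇ-punchIn {suc M} (fsuc i) (fsuc a) (fsuc b) = <ᵇ-punchIn i a b

  <ᵇ-punchIn-pivot : ∀ {M} (i : Fin (suc M)) (b : Fin M) → (toℕ (punchIn i b) <ᵇ toℕ i) ≡ (toℕ b <ᵇ toℕ i)
  <ᵇ-punchIn-pivot fzero b = refl
  <ᵇ-punchIn-pivot {suc M} (fsuc i) fzero = refl
  <ᵇ-punchIn-pivot {suc M} (fsuc i) (fsuc b) = <ᵇ-punchIn-pivot i b

  descents-punchIn : ∀ {M k} (i : Fin (suc M)) (w : Vec (Fin M) k) → descents (map (punchIn i) w) ≡ descents w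
  descents-punchIn i [] = refl
  descents-punchIn i (a ∷ []) = refl
  descents-punchIn i (a ∷ b ∷ w) = cong₂ (λ t D → ⟦ t ⟧ + D) (<ᵇ-punchIn i a b) (descents-punchIn i (b ∷ w))

  -- punchIn i maps the words over Fin M bijectively onto the words over Fin (suc M) that avoid i.
  sumL-fresh : ∀ M k (i : Fin (suc M)) (g : Vec (Fin (suc M)) k → Bool) →
    sumL (λ w → ⟦ fresh i w ∧ g w ⟧) (allSeqs (suc M) k) ≡ sumL (λ w → ⟦ g (map (punchIn i) w) ⟧) (allSeqs M k)
  sumL-fresh M zero i g = refl
  sumL-fresh M (suc k) i g = begin
    sumL (λ w → ⟦ fresh i w ∧ g w ⟧) (allSeqs (suc M) (suc k))
      ≡⟨ sumL-allSeqs (suc M) k _ ⟩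
    sum (λ j → sumL (λ w → ⟦ (not (does (i ≟F j)) ∧ fresh i w) ∧ g (j ∷ w) ⟧) (allSeqs (suc M) k))
      ≡⟨ sum-cong-≗ first-letter ⟩
    sum (λ j → if does (i ≟F j) then 0 else sumL (λ w → ⟦ g (j ∷ map (punchIn i) w) ⟧) (allSeqs M k))
      ≡⟨ sum-punchIn M i (λ j → sumL (λ w → ⟦ g (j ∷ map (punchIn i) w) ⟧) (allSeqs M k)) ⟩
    sum (λ j → sumL (λ w → ⟦ g (punchIn i j ∷ map (punchIn i) w) ⟧) (allSeqs M k))
      ≡⟨ sym (sumL-allSeqs M k _) ⟩
    sumL (λ w → ⟦ g (map (punchIn i) w) ⟧) (allSeqs M (suc k)) ∎
    where
    open ≡-Reasoning
    first-letter : ∀ j → sumL (λ w → ⟦ (not (does (i ≟F j)) ∧ fresh i w) ∧ g (j ∷ w) ⟧) (allSeqs (suc M) k)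
                         ≡ (if does (i ≟F j) then 0 else sumL (λ w → ⟦ g (j ∷ map (punchIn i) w) ⟧) (allSeqs M k))
    first-letter j with does (i ≟F j)
    ... | true = sumL-zero (allSeqs (suc M) k)
    ... | false = sumL-fresh M k i (λ w → g (j ∷ w))

  ⟦⟧-descent-split : ∀ (P : ℕ → Bool) u t D →
    ⟦ u ∧ P (⟦ t ⟧ + D) ⟧ ≡ ⟦ not t ⟧ * ⟦ u ∧ P D ⟧ + ⟦ t ⟧ * ⟦ u ∧ P (suc D) ⟧
  ⟦⟧-descent-split P u false D = sym (trans (+-identityʳ (1 * ⟦ u ∧ P D ⟧)) (*-identityˡ ⟦ u ∧ P D ⟧))
  ⟦⟧-descent-split P u true D = sym (*-identityˡ ⟦ u ∧ P (suc D) ⟧)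

  permSum-suc : ∀ N P h → permSum (suc N) P h ≡
    sumℕ (suc (suc N)) (λ x → h x * (permSum N P (atLeast x) + permSum N (λ D → P (suc D)) (below x)))
  permSum-suc N P h = begin
    permSum (suc N) P h
      ≡⟨ sumL-allSeqs (suc (suc N)) (suc N) _ ⟩
    sum (λ (i : Fin (suc (suc N))) → sumL (λ w → h (toℕ i) * ⟦ (fresh i w ∧ distinct w) ∧ P (descents (i ∷ w)) ⟧) words)
      ≡⟨ sum-cong-≗ first-letter ⟩
    sum (λ (i : Fin (suc (suc N))) → F (toℕ i))
      ≡⟨ sum-toℕ (suc (suc N)) F ⟩
    sumℕ (suc (suc N)) F ∎
    where
    open ≡-Reasoning
    words : List (Vec (Fin (suc (suc N))) (suc N))
    words = allSeqs (suc (suc N)) (suc N)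
    rest : List (Vec (Fin (suc N)) (suc N))
    rest = allSeqs (suc N) (suc N)
    F : ℕ → ℕ
    F x = h x * (permSum N P (atLeast x) + permSum N (λ D → P (suc D)) (below x))
    split : ∀ i (w : Vec (Fin (suc N)) (suc N)) →
      ⟦ distinct (map (punchIn i) w) ∧ P (descents (i ∷ map (punchIn i) w)) ⟧
        ≡ atLeast (toℕ i) (toℕ (head w)) * ⟦ distinct w ∧ P (descents w) ⟧
          + below (toℕ i) (toℕ (head w)) * ⟦ distinct w ∧ P (suc (descents w)) ⟧
    split i w@(b ∷ _) =
      trans (cong₂ (λ u D → ⟦ u ∧ P D ⟧) (distinct-punchIn i w)
                   (cong₂ (λ t D → ⟦ t ⟧ + D) (<ᵇ-punchIn-pivot i b) (descents-punchIn i w)))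
            (⟦⟧-descent-split P (distinct w) (toℕ b <ᵇ toℕ i) (descents w))
    first-letter : ∀ i → sumL (λ w → h (toℕ i) * ⟦ (fresh i w ∧ distinct w) ∧ P (descents (i ∷ w)) ⟧) words ≡ F (toℕ i)
    first-letter i = begin
      sumL (λ w → h (toℕ i) * ⟦ (fresh i w ∧ distinct w) ∧ P (descents (i ∷ w)) ⟧) words
        ≡⟨ sumL-cong words (λ w → cong (λ b → h (toℕ i) * ⟦ b ⟧) (∧-assoc (fresh i w) (distinct w) _)) ⟩
      sumL (λ w → h (toℕ i) * ⟦ fresh i w ∧ (distinct w ∧ P (descents (i ∷ w))) ⟧) words
        ≡⟨ sumL-*ˡ (h (toℕ i)) _ words ⟩
      h (toℕ i) * sumL (λ w → ⟦ fresh i w ∧ (distinct w ∧ P (descents (i ∷ w))) ⟧) words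
        ≡⟨ cong (h (toℕ i) *_) (sumL-fresh (suc N) (suc N) i (λ w → distinct w ∧ P (descents (i ∷ w)))) ⟩
      h (toℕ i) * sumL (λ w → ⟦ distinct (map (punchIn i) w) ∧ P (descents (i ∷ map (punchIn i) w)) ⟧) rest
        ≡⟨ cong (h (toℕ i) *_) (trans (sumL-cong rest (split i)) (sumL-+ _ _ rest)) ⟩
      F (toℕ i) ∎

  permSum-never : ∀ N g → permSum N (λ _ → false) g ≡ 0
  permSum-never N g =
    trans (sumL-cong (allSeqs (suc N) (suc N)) (λ v → trans (cong (λ b → g (toℕ (head v)) * ⟦ b ⟧) (∧-zeroʳ (distinct v))) (*-zeroʳ (g (toℕ (head v))))))
          (sumL-zero (allSeqs (suc N) (suc N)))

open import Defs
open PowerSums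
open Permutations
open import Data.Nat as ℕ using (ℕ; zero; suc; _∸_; _≤_; _<_; _≡ᵇ_; _!; s≤s)
import Data.Nat.Properties as ℕ
open import Data.Nat.Combinatorics using (_C_; nCk+nC[k+1]≡[n+1]C[k+1]; k>n⇒nCk≡0)
open import Data.Integer using (ℤ; +_; -1ℤ; 0ℤ; 1ℤ; _+_; _*_; _-_; _^_)
open import Data.Integer.Properties using (pos-+; pos-*; +-identityˡ; *-zeroʳ; *-distribˡ-+; +-assoc; +-comm; +-commutativeSemigroup; +-*-ring)
open import Data.Integer.Tactic.RingSolver using (solve-∀)
open import Relation.Binary.PropositionalEquality using (_≡_; refl; sym; trans; cong; cong₂; module ≡-Reasoning)
open import Algebra.Properties.Ring +-*-ring using (x[y-z]≈xy-xz; [y-z]x≈yx-zx)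
open import Algebra.Properties.CommutativeSemigroup +-commutativeSemigroup using () renaming (interchange to +-interchange)

sumℤ-cong : ∀ K {f g : ℕ → ℤ} → (∀ i → i < K → f i ≡ g i) → sumℤ K f ≡ sumℤ K g
sumℤ-cong zero eq = refl
sumℤ-cong (suc K) eq = cong₂ _+_ (sumℤ-cong K (λ i i<K → eq i (ℕ.≤-trans i<K (ℕ.n≤1+n K)))) (eq K ℕ.≤-refl)

sumℤ-+ : ∀ K (f g : ℕ → ℤ) → sumℤ K (λ i → f i + g i) ≡ sumℤ K f + sumℤ K g
sumℤ-+ zero f g = refl
sumℤ-+ (suc K) f g = trans (cong (_+ (f K + g K)) (sumℤ-+ K f g)) (+-interchange (sumℤ K f) (sumℤ K g) (f K) (g K))

sumℤ-*ˡ : ∀ K c (f : ℕ → ℤ) → sumℤ K (λ i → c * f i) ≡ c * sumℤ K f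
sumℤ-*ˡ zero c f = sym (*-zeroʳ c)
sumℤ-*ˡ (suc K) c f = trans (cong (_+ c * f K) (sumℤ-*ˡ K c f)) (sym (*-distribˡ-+ c (sumℤ K f) (f K)))

sumℤ-minus : ∀ K (f g : ℕ → ℤ) → sumℤ K (λ i → f i - g i) ≡ sumℤ K f - sumℤ K g
sumℤ-minus zero f g = refl
sumℤ-minus (suc K) f g = trans (cong (_+ (f K - g K)) (sumℤ-minus K f g)) (regroup (sumℤ K f) (sumℤ K g) (f K) (g K))
  where
  regroup : ∀ a b c d → a - b + (c - d) ≡ a + c - (b + d)
  regroup = solve-∀

sumℤ-zero : ∀ K → sumℤ K (λ _ → 0ℤ) ≡ 0ℤ
sumℤ-zero zero = refl
sumℤ-zero (suc K) = cong (_+ 0ℤ) (sumℤ-zero K)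

sumℤ-swap : ∀ K L (f : ℕ → ℕ → ℤ) → sumℤ K (λ i → sumℤ L (f i)) ≡ sumℤ L (λ j → sumℤ K (λ i → f i j))
sumℤ-swap zero L f = sym (sumℤ-zero L)
sumℤ-swap (suc K) L f = trans (cong (_+ sumℤ L (f K)) (sumℤ-swap K L f)) (sym (sumℤ-+ L _ (f K)))

sumℤ-head : ∀ K (f : ℕ → ℤ) → sumℤ (suc K) f ≡ f 0 + sumℤ K (λ i → f (suc i))
sumℤ-head zero f = +-comm 0ℤ (f 0)
sumℤ-head (suc K) f = trans (cong (_+ f (suc K)) (sumℤ-head K f)) (+-assoc (f 0) _ _)

pos-sumℕ-* : ∀ K (f g : ℕ → ℕ) → + sumℕ K (λ i → f i ℕ.* g i) ≡ sumℤ K (λ i → + f i * + g i)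
pos-sumℕ-* zero f g = refl
pos-sumℕ-* (suc K) f g =
  trans (pos-+ (sumℕ K (λ i → f i ℕ.* g i)) (f K ℕ.* g K)) (cong₂ _+_ (pos-sumℕ-* K f g) (pos-* (f K) (g K)))

sumℤ-*-sumℤ : ∀ K L (a u : ℕ → ℤ) (v : ℕ → ℕ → ℤ) →
  sumℤ K (λ y → a y * sumℤ L (λ j → u j * v j y)) ≡ sumℤ L (λ j → u j * sumℤ K (λ y → a y * v j y))
sumℤ-*-sumℤ K L a u v = begin
  sumℤ K (λ y → a y * sumℤ L (λ j → u j * v j y))   ≡⟨ sumℤ-cong K (λ y _ → sym (sumℤ-*ˡ L (a y) _)) ⟩
  sumℤ K (λ y → sumℤ L (λ j → a y * (u j * v j y))) ≡⟨ sumℤ-swap K L _ ⟩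
  sumℤ L (λ j → sumℤ K (λ y → a y * (u j * v j y))) ≡⟨ sumℤ-cong L (λ j _ → trans (sumℤ-cong K (λ y _ → leftComm (a y) (u j) (v j y))) (sumℤ-*ˡ K (u j) _)) ⟩
  sumℤ L (λ j → u j * sumℤ K (λ y → a y * v j y))   ∎
  where
  open ≡-Reasoning
  leftComm : ∀ a u v → a * (u * v) ≡ u * (a * v)
  leftComm = solve-∀

pos-cancel : ∀ {a e b} → a ℕ.+ e ≡ b → + a ≡ + b - + e
pos-cancel {a} {e} refl = trans (addSub (+ a) (+ e)) (cong (_- + e) (sym (pos-+ a e)))
  where
  addSub : ∀ a e → a ≡ (a + e) - e
  addSub = solve-∀

sumℤ-atLeast-mixedPow : ∀ N j {x} → x ≤ suc N →
  sumℤ (suc N) (λ y → + atLeast x y * + mixedPow N j y) ≡ + mixedPow (suc N) j x - + (j ℕ.^ suc N)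
sumℤ-atLeast-mixedPow N j {x} x≤ = trans (sym (pos-sumℕ-* (suc N) (atLeast x) (mixedPow N j))) (pos-cancel (sumℕ-atLeast-mixedPow N j x≤))

sumℤ-below-mixedPow : ∀ N j {x} → x ≤ suc N →
  sumℤ (suc N) (λ y → + below x y * + mixedPow N j y) ≡ + (suc j ℕ.^ suc N) - + mixedPow (suc N) j x
sumℤ-below-mixedPow N j {x} x≤ = trans (sym (pos-sumℕ-* (suc N) (below x) (mixedPow N j))) (pos-cancel (sumℕ-below-mixedPow N j x≤))

alternating : ℕ → ℕ → ℕ → ℤ
alternating n d j = -1ℤ ^ (d ∸ j) * + (n C (d ∸ j))

alternating-diag : ∀ n d → alternating n d d ≡ 1ℤ
alternating-diag n d rewrite ℕ.n∸n≡0 d = refl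

alternating-pascal : ∀ N d {j} → j ≤ d →
  alternating (suc (suc N)) (suc d) j ≡ alternating (suc N) (suc d) j - alternating (suc N) d j
alternating-pascal N d {j} j≤d rewrite ℕ.+-∸-assoc 1 j≤d | sym (nCk+nC[k+1]≡[n+1]C[k+1] (suc N) (d ∸ j))
  | pos-+ (suc N C (d ∸ j)) (suc N C suc (d ∸ j)) = flip (-1ℤ ^ (d ∸ j)) (+ (suc N C (d ∸ j))) (+ (suc N C suc (d ∸ j)))
  where
  flip : ∀ s a b → -1ℤ * s * (a + b) ≡ -1ℤ * s * b - s * a
  flip = solve-∀

-- The number of π ∈ S_(N+1) with d descents and π(1) = x + 1, as permSum-refinedEulerian shows.
refinedEulerian : ℕ → ℕ → ℕ → ℤ
refinedEulerian N d x = sumℤ (suc d) (λ j → alternating (suc N) d j * + mixedPow N j x)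

-- Counts the π ∈ S_(N+2) with d descents and π(1) = x + 1 > π(2).
descendingStart : ℕ → ℕ → ℕ → ℤ
descendingStart N zero x = 0ℤ
descendingStart N (suc d) x = sumℤ (suc N) (λ y → + below x y * refinedEulerian N d y)

sumℤ-atLeast-refinedEulerian : ∀ N d {x} → x ≤ suc N →
  sumℤ (suc N) (λ y → + atLeast x y * refinedEulerian N d y)
    ≡ sumℤ (suc d) (λ j → alternating (suc N) d j * (+ mixedPow (suc N) j x - + (j ℕ.^ suc N)))
sumℤ-atLeast-refinedEulerian N d {x} x≤ =
  trans (sumℤ-*-sumℤ (suc N) (suc d) (λ y → + atLeast x y) (alternating (suc N) d) (λ j y → + mixedPow N j y))
        (sumℤ-cong (suc d) (λ j _ → cong (alternating (suc N) d j *_) (sumℤ-atLeast-mixedPow N j x≤)))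

sumℤ-below-refinedEulerian : ∀ N d {x} → x ≤ suc N →
  sumℤ (suc N) (λ y → + below x y * refinedEulerian N d y)
    ≡ sumℤ (suc d) (λ j → alternating (suc N) d j * (+ (suc j ℕ.^ suc N) - + mixedPow (suc N) j x))
sumℤ-below-refinedEulerian N d {x} x≤ =
  trans (sumℤ-*-sumℤ (suc N) (suc d) (λ y → + below x y) (alternating (suc N) d) (λ j y → + mixedPow N j y))
        (sumℤ-cong (suc d) (λ j _ → cong (alternating (suc N) d j *_) (sumℤ-below-mixedPow N j x≤)))

refinedEulerian-suc : ∀ N d {x} → x ≤ suc N →
  refinedEulerian (suc N) d x ≡ sumℤ (suc N) (λ y → + atLeast x y * refinedEulerian N d y) + descendingStart N d x
refinedEulerian-suc N zero {x} x≤ = trans (base (+ mixedPow (suc N) 0 x)) (cong (_+ 0ℤ) (sym (sumℤ-atLeast-refinedEulerian N 0 x≤)))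
  where
  base : ∀ b → 0ℤ + 1ℤ * + 1 * b ≡ (0ℤ + 1ℤ * + 1 * (b - 0ℤ)) + 0ℤ
  base = solve-∀
refinedEulerian-suc N (suc d) {x} x≤ = begin
  sumℤ (suc d) (λ j → v j * B j) + v (suc d) * B (suc d)
    ≡⟨ cong₂ _+_ (trans (sumℤ-cong (suc d) pascal) (sumℤ-minus (suc d) _ _)) (cong (_* B (suc d)) leading) ⟩
  X - Y + t
    ≡⟨ regroup X Y Z t (u 0) ⟩
  (X + t - (u 0 * 0ℤ + Z)) + (Z - Y)
    ≡⟨ sym (cong₂ _+_ shifted (sumℤ-distrib (suc d) u′ (λ j → E (suc j)) B)) ⟩
  sumℤ (suc (suc d)) (λ j → u j * (B j - E j)) + sumℤ (suc d) (λ j → u′ j * (E (suc j) - B j))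
    ≡⟨ sym (cong₂ _+_ (sumℤ-atLeast-refinedEulerian N (suc d) x≤) (sumℤ-below-refinedEulerian N d x≤)) ⟩
  sumℤ (suc N) (λ y → + atLeast x y * refinedEulerian N (suc d) y) + descendingStart N (suc d) x ∎
  where
  open ≡-Reasoning
  B E : ℕ → ℤ
  B j = + mixedPow (suc N) j x
  E j = + (j ℕ.^ suc N)
  u u′ v : ℕ → ℤ
  u = alternating (suc N) (suc d)
  u′ = alternating (suc N) d
  v = alternating (suc (suc N)) (suc d)
  X Y Z t : ℤ
  X = sumℤ (suc d) (λ j → u j * B j)
  Y = sumℤ (suc d) (λ j → u′ j * B j)
  Z = sumℤ (suc d) (λ j → u′ j * E (suc j))
  t = u (suc d) * B (suc d)
  leading : v (suc d) ≡ u (suc d)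
  leading = trans (alternating-diag (suc (suc N)) (suc d)) (sym (alternating-diag (suc N) (suc d)))
  pascal : ∀ j → j < suc d → v j * B j ≡ u j * B j - u′ j * B j
  pascal j j≤d = trans (cong (_* B j) (alternating-pascal N d (ℕ.≤-pred j≤d))) ([y-z]x≈yx-zx (B j) (u j) (u′ j))
  sumℤ-distrib : ∀ K (c f g : ℕ → ℤ) → sumℤ K (λ j → c j * (f j - g j)) ≡ sumℤ K (λ j → c j * f j) - sumℤ K (λ j → c j * g j)
  sumℤ-distrib K c f g = trans (sumℤ-cong K (λ j _ → x[y-z]≈xy-xz (c j) (f j) (g j))) (sumℤ-minus K _ _)
  shifted : sumℤ (suc (suc d)) (λ j → u j * (B j - E j)) ≡ X + t - (u 0 * 0ℤ + Z)
  shifted = trans (sumℤ-distrib (suc (suc d)) u B E) (cong (X + t -_) (sumℤ-head (suc d) (λ j → u j * E j)))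
  regroup : ∀ X Y Z t w → X - Y + t ≡ (X + t - (w * 0ℤ + Z)) + (Z - Y)
  regroup = solve-∀

refinedEulerian-base : ∀ d → refinedEulerian 0 d 0 ≡ + ⟦ 0 ≡ᵇ d ⟧
refinedEulerian-base zero = refl
refinedEulerian-base (suc d) = begin
  sumℤ d f + f d + f (suc d)  ≡⟨ cong₂ (λ s t → s + t + f (suc d)) (trans (sumℤ-cong d vanishing) (sumℤ-zero d)) penultimate ⟩
  0ℤ + -1ℤ + f (suc d)        ≡⟨ cong (λ c → 0ℤ + -1ℤ + c * + 1) (alternating-diag 1 d) ⟩
  0ℤ                          ∎
  where
  open ≡-Reasoning
  f : ℕ → ℤ
  f j = alternating 1 (suc d) j * + 1
  penultimate : f d ≡ -1ℤ
  penultimate = cong (λ e → -1ℤ ^ e * + (1 C e) * + 1) (ℕ.m+n∸n≡m 1 d)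
  vanishing : ∀ j → j < d → f j ≡ 0ℤ
  vanishing j j<d = trans (cong (λ c → -1ℤ ^ (suc d ∸ j) * + c * + 1) (k>n⇒nCk≡0 (ℕ.m+n≤o⇒m≤o∸n 2 (s≤s j<d))))
                          (cong (_* + 1) (*-zeroʳ (-1ℤ ^ (suc d ∸ j))))

permSum-refinedEulerian : ∀ N d h → + permSum N (_≡ᵇ d) h ≡ sumℤ (suc N) (λ x → + h x * refinedEulerian N d x)
permSum-refinedEulerian zero d h = begin
  + (h 0 ℕ.* ⟦ 0 ≡ᵇ d ⟧ ℕ.+ 0)  ≡⟨ cong +_ (ℕ.+-identityʳ _) ⟩
  + (h 0 ℕ.* ⟦ 0 ≡ᵇ d ⟧)        ≡⟨ pos-* (h 0) ⟦ 0 ≡ᵇ d ⟧ ⟩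
  + h 0 * + ⟦ 0 ≡ᵇ d ⟧          ≡⟨ cong (+ h 0 *_) (sym (refinedEulerian-base d)) ⟩
  + h 0 * refinedEulerian 0 d 0 ≡⟨ sym (+-identityˡ _) ⟩
  0ℤ + + h 0 * refinedEulerian 0 d 0 ∎
  where open ≡-Reasoning
permSum-refinedEulerian (suc N) d h = begin
  + permSum (suc N) (_≡ᵇ d) h
    ≡⟨ cong +_ (permSum-suc N (_≡ᵇ d) h) ⟩
  + sumℕ (suc (suc N)) (λ x → h x ℕ.* (permSum N (_≡ᵇ d) (atLeast x) ℕ.+ permSum N (λ D → suc D ≡ᵇ d) (below x)))
    ≡⟨ pos-sumℕ-* (suc (suc N)) h _ ⟩
  sumℤ (suc (suc N)) (λ x → + h x * + (permSum N (_≡ᵇ d) (atLeast x) ℕ.+ permSum N (λ D → suc D ≡ᵇ d) (below x)))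
    ≡⟨ sumℤ-cong (suc (suc N)) (λ x x<N+2 → cong (+ h x *_) (first-letter x (ℕ.≤-pred x<N+2))) ⟩
  sumℤ (suc (suc N)) (λ x → + h x * refinedEulerian (suc N) d x) ∎
  where
  open ≡-Reasoning
  descending : ∀ d x → + permSum N (λ D → suc D ≡ᵇ d) (below x) ≡ descendingStart N d x
  descending zero x = cong +_ (permSum-never N (below x))
  descending (suc d) x = permSum-refinedEulerian N d (below x)
  first-letter : ∀ x → x ≤ suc N →
    + (permSum N (_≡ᵇ d) (atLeast x) ℕ.+ permSum N (λ D → suc D ≡ᵇ d) (below x)) ≡ refinedEulerian (suc N) d x
  first-letter x x≤ = begin
    + (permSum N (_≡ᵇ d) (atLeast x) ℕ.+ permSum N (λ D → suc D ≡ᵇ d) (below x))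
      ≡⟨ pos-+ (permSum N (_≡ᵇ d) (atLeast x)) _ ⟩
    + permSum N (_≡ᵇ d) (atLeast x) + + permSum N (λ D → suc D ≡ᵇ d) (below x)
      ≡⟨ cong₂ _+_ (permSum-refinedEulerian N d (atLeast x)) (descending d x) ⟩
    sumℤ (suc N) (λ y → + atLeast x y * refinedEulerian N d y) + descendingStart N d x
      ≡⟨ sym (refinedEulerian-suc N d x≤) ⟩
    refinedEulerian (suc N) d x ∎

sumℤ-rising-refinedEulerian : ∀ N d m →
  sumℤ (suc N) (λ x → + rising (suc x) m * refinedEulerian N d x)
    ≡ + (m !) * sumℤ (suc d) (λ j → alternating (suc N) d j * + sumℕ (suc N) (λ l → ((m ℕ.+ suc N) C l) ℕ.* j ℕ.^ l))
sumℤ-rising-refinedEulerian N d m =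
  trans (sumℤ-*-sumℤ (suc N) (suc d) (λ x → + rising (suc x) m) (alternating (suc N) d) (λ j x → + mixedPow N j x))
        (trans (sumℤ-cong (suc d) (λ j _ → moment j)) (sumℤ-*ˡ (suc d) (+ (m !)) _))
  where
  open ≡-Reasoning
  S : ℕ → ℕ
  S j = sumℕ (suc N) (λ l → ((m ℕ.+ suc N) C l) ℕ.* j ℕ.^ l)
  leftComm : ∀ a u v → a * (u * v) ≡ u * (a * v)
  leftComm = solve-∀
  moment : ∀ j → alternating (suc N) d j * sumℤ (suc N) (λ x → + rising (suc x) m * + mixedPow N j x)
                   ≡ + (m !) * (alternating (suc N) d j * + S j)
  moment j = begin
    alternating (suc N) d j * sumℤ (suc N) (λ x → + rising (suc x) m * + mixedPow N j x)
      ≡⟨ cong (alternating (suc N) d j *_) (sym (pos-sumℕ-* (suc N) (λ x → rising (suc x) m) (mixedPow N j))) ⟩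
    alternating (suc N) d j * + sumℕ (suc N) (λ x → rising (suc x) m ℕ.* mixedPow N j x)
      ≡⟨ cong (λ s → alternating (suc N) d j * + s) (sumℕ-rising-mixedPow m N j) ⟩
    alternating (suc N) d j * + (m ! ℕ.* S j)
      ≡⟨ cong (alternating (suc N) d j *_) (pos-* (m !) (S j)) ⟩
    alternating (suc N) d j * (+ (m !) * + S j)
      ≡⟨ leftComm (alternating (suc N) d j) (+ (m !)) (+ S j) ⟩
    + (m !) * (alternating (suc N) d j * + S j) ∎

binomDiff-≤ : ∀ n {d j} → j ≤ d → binomDiff n d j ≡ n C (d ∸ j)
binomDiff-≤ n {j = zero} _ = refl
binomDiff-≤ n (s≤s j≤d) = binomDiff-≤ n j≤d

rhs-alternating : ∀ N d m →
  rhs (suc N) d m ≡ + (m !) * sumℤ (suc d) (λ j → alternating (suc N) d j * + sumℕ (suc N) (λ l → ((m ℕ.+ suc N) C l) ℕ.* j ℕ.^ l))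
rhs-alternating N d m = cong (+ (m !) *_) (sumℤ-cong (suc d) (λ j j≤d →
  cong (λ c → -1ℤ ^ (d ∸ j) * + c * + sumℕ (suc N) (λ l → ((m ℕ.+ suc N) C l) ℕ.* j ℕ.^ l)) (binomDiff-≤ (suc N) (ℕ.≤-pred j≤d))))

lemma2 : (n d m : ℕ) → 1 ≤ n → d < n →
    + (eulerianTimesCondExp n d m) ≡ rhs n d m
lemma2 (suc N) d m _ _ = begin
  + eulerianTimesCondExp (suc N) d m                             ≡⟨ cong +_ (eulerianTimesCondExp-permSum N d m) ⟩
  + permSum N (_≡ᵇ d) (λ x → rising (suc x) m)                   ≡⟨ permSum-refinedEulerian N d (λ x → rising (suc x) m) ⟩
  sumℤ (suc N) (λ x → + rising (suc x) m * refinedEulerian N d x) ≡⟨ sumℤ-rising-refinedEulerian N d m ⟩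
  + (m !) * sumℤ (suc d) (λ j → alternating (suc N) d j * + sumℕ (suc N) (λ l → ((m ℕ.+ suc N) C l) ℕ.* j ℕ.^ l))
                                                                 ≡⟨ sym (rhs-alternating N d m) ⟩
  rhs (suc N) d m                                                ∎
  where open ≡-Reasoning
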